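{- Let $T$ and $T'$ be finite vertex-colored arborescences with colors in $\mathbb{N}$. Then $T$ and $T'$ are isomorphic as vertex-colored arborescences if and only if the arrays $\overline{\mathrm{L}\mathcal{D}_A}(T)$ and $\overline{\mathrm{L}\mathcal{D}_A}(T')$ are identical.
   Context: A vertex-colored arborescence is a finite directed tree $T$ with a root $r$ such that every edge is directed away from $r$, together with a coloring $c:V(T)\to\mathbb{N}$ (not necessarily proper: adjacent vertices may have the same color). A vertex-colored isomorphism between two such arborescences is a bijection of vertex sets that maps directed edges exactly onto directed edges (preserving adjacency, non-adjacency and direction) and preserves colors. For $v\in V(T)$, $T[v]$ denotes the subarborescence consisting of $v$ and all its descendants, rooted at $v$. Arrays are compared lexicographically: for arrays $x,y$ (whose entries are integers, or arrays compared recursively in the same way), $x<y$ iff there is an index $i$ with $x[j]=y[j]$ for all $j<i$ and either $x[i]<y[i]$, or $x$ has length $i$ while $y$ has length greater than $i$. The lexicographic depth-first search array is defined recursively: if $u$ has no children, $\mathrm{L}\mathcal{D}_A(T[u])=[[\,]]$ (an array whose only entry is the empty array); otherwise, list the children of $u$ as $n_1,\dots,n_k$ sorted so that $n_a$ precedes $n_b$ whenever $c(n_a)<c(n_b)$, or $c(n_a)=c(n_b)$ and $\mathrm{L}\mathcal{D}_A(T[n_a])<\mathrm{L}\mathcal{D}_A(T[n_b])$ (remaining ties broken arbitrarily), and set $\mathrm{L}\mathcal{D}_A(T[u])=[[c(n_1),\dots,c(n_k)]]+\mathrm{L}\mathcal{D}_A(T[n_1])+\cdots+\mathrm{L}\mathcal{D}_A(T[n_k])$,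 where $+$ denotes concatenation of arrays. Write $\mathrm{L}\mathcal{D}_A(T)=\mathrm{L}\mathcal{D}_A(T[r])$. The full array is $\overline{\mathrm{L}\mathcal{D}_A}(T)=[[c(r)]]+\mathrm{L}\mathcal{D}_A(T)$. -}

module Defs where

open import Data.Nat using (ℕ; zero; suc) renaming (_<ᵇ_ to _<ℕᵇ_; _≡ᵇ_ to _≡ℕᵇ_)
open import Data.Bool using (Bool; true; false; if_then_else_; _∧_; _∨_)
open import Data.Fin using (Fin)
open import Data.List using (List; []; _∷_; _++_; map; concat; allFin)
open import Data.Product using (_×_; _,_; proj₁; proj₂; ∃; ∃-syntax)
open import Relation.Binary.PropositionalEquality using (_≡_; _≢_)
open import Relation.Binary.Construct.Closure.ReflexiveTransitive using (Star)
open import Function.Bundles using (_↔_; Inverse)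

Edge : ℕ → Set
Edge n = Fin n → Fin n → Bool

_⟶[_]_ : ∀ {n} → Fin n → Edge n → Fin n → Set
u ⟶[ E ] v = E u v ≡ true

record ColoredArborescence : Set where
  field
    n       : ℕ
    root    : Fin n
    E       : Edge n
    colour  : Fin n → ℕ
    root-no-parent : ∀ v → E v root ≡ false
    unique-parent  : ∀ v → v ≢ root →
                     ∃[ p ] (E p v ≡ true × (∀ q → E q v ≡ true → q ≡ p))
    reachable      : ∀ v → Star (λ a b → a ⟶[ E ] b) root v

open ColoredArborescence public

record ColIso (T T' : ColoredArborescence) : Set where
  field
    bij      : Fin (n T) ↔ Fin (n T')
  f : Fin (n T) → Fin (n T')
  f = Inverse.to bij
  field
    edges    : ∀ u v → E T' (f u) (f v) ≡ E T u v
    colours  : ∀ u → colour T' (f u) ≡ colour T u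

Isomorphic : ColoredArborescence → ColoredArborescence → Set
Isomorphic T T' = ColIso T T'

lexLt : {A : Set} → (A → A → Bool) → (A → A → Bool) → List A → List A → Bool
lexLt lt eq []       []       = false
lexLt lt eq []       (_ ∷ _)  = true
lexLt lt eq (_ ∷ _)  []       = false
lexLt lt eq (x ∷ xs) (y ∷ ys) = lt x y ∨ (eq x y ∧ lexLt lt eq xs ys)

lexEq : {A : Set} → (A → A → Bool) → List A → List A → Bool
lexEq eq []       []       = true
lexEq eq []       (_ ∷ _)  = false
lexEq eq (_ ∷ _)  []       = false
lexEq eq (x ∷ xs) (y ∷ ys) = eq x y ∧ lexEq eq xs ys

ltL : List ℕ → List ℕ → Bool
ltL = lexLt _<ℕᵇ_ _≡ℕᵇ_

eqL : List ℕ → List ℕ → Bool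
eqL = lexEq _≡ℕᵇ_

ltLL : List (List ℕ) → List (List ℕ) → Bool
ltLL = lexLt ltL eqL

keyLt : ℕ × List (List ℕ) → ℕ × List (List ℕ) → Bool
keyLt (c , a) (d , b) = (c <ℕᵇ d) ∨ ((c ≡ℕᵇ d) ∧ ltLL a b)

-- insertion sort (ties broken arbitrarily: tied keys are identical)
insert : ℕ × List (List ℕ) → List (ℕ × List (List ℕ)) → List (ℕ × List (List ℕ))
insert x []       = x ∷ []
insert x (y ∷ ys) = if keyLt y x then y ∷ insert x ys else x ∷ y ∷ ys

sortKeys : List (ℕ × List (List ℕ)) → List (ℕ × List (List ℕ))
sortKeys []       = []
sortKeys (x ∷ xs) = insert x (sortKeys xs)

filterB : {A : Set} → (A → Bool) → List A → List A
filterB p []       = []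
filterB p (x ∷ xs) = if p x then x ∷ filterB p xs else filterB p xs

children : (T : ColoredArborescence) → Fin (n T) → List (Fin (n T))
children T u = filterB (E T u) (allFin (n T))

-- LD with fuel; fuel n T suffices since every root-to-leaf path has < n vertices.
-- A leaf yields [[ ]] (its sorted child list is empty).
LDfuel : (T : ColoredArborescence) → ℕ → Fin (n T) → List (List ℕ)
LDfuel T zero    u = [] ∷ []
LDfuel T (suc k) u =
  let ks = sortKeys (map (λ v → colour T v , LDfuel T k v) (children T u))
  in map proj₁ ks ∷ concat (map proj₂ ks)

LDsub : (T : ColoredArborescence) → Fin (n T) → List (List ℕ)
LDsub T u = LDfuel T (n T) u

LD : ColoredArborescence → List (List ℕ)
LD T = LDsub T (root T)

LDbar : ColoredArborescence → List (List ℕ)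
LDbar T = (colour T (root T) ∷ []) ∷ LD T

{-# OPTIONS --safe #-}
-- An isomorphism maps the children of each vertex bijectively onto the children of its
-- image, preserving colours and, by induction on the fuel, the arrays of the subtrees.
-- Sorting by the strict total order on (colour, array) keys does not depend on the order
-- of its input, so the arrays of T and T′ coincide.
--
-- Conversely, list the vertices of a tree depth-first, children in sorted order: this is
-- the order in which the array describes them, one entry per vertex. Arrays are prefix
-- codes (the first entry lists the colours of the children, so it fixes how many
-- sub-arrays follow), hence equal arrays split child by child into equal pieces, and
-- pairing the two listings position by position matches each child of a vertex with an
-- equally coloured child of its partner. Both listings enumerate every vertex exactly
-- once, so this pairing is a colour-preserving bijection mapping edges onto edges.

module Submission where

open import Defs
open import Data.Nat using (ℕ)
open import Data.List using (List)
open import Relation.Binary.PropositionalEquality using (_≡_)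
open import Data.Product using (_×_)

open import Data.Bool using (Bool; true; false; T; _∧_; _∨_)
open import Data.Bool.Properties using (T-≡; T-∧; T-∨; ⇔→≡)
open import Data.Empty using (⊥-elim)
open import Data.Fin as Fin using (Fin; toℕ; zero; suc)
open import Data.Fin.Properties using (pigeonhole; cantor-schröder-bernstein)
open import Data.List using ([]; _∷_; _++_; map; concat; concatMap; length; filter; allFin; zip)
open import Data.List.Properties
  using (map-∘; map-cong; length-++; length-map; ∷-injective; ++-assoc)
open import Data.List.Membership.Propositional using (_∈_; _∉_; find; lose)
open import Data.List.Membership.Propositional.Properties
  using (∈-map⁺; ∈-map⁻; ∈-concatMap⁻; ∈-concatMap⁺; ∈-filter⁺; ∈-filter⁻; ∈-allFin)
open import Data.List.Membership.Propositional.Properties.WithK using (unique∧set⇒bag)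
open import Data.List.Relation.Binary.BagAndSetEquality using (_∼[_]_; set; ∼bag⇒↭)
open import Data.List.Relation.Binary.Lex.Core using (base; halt; this; next)
open import Data.List.Relation.Binary.Lex.Strict using (Lex-<; <-isStrictTotalOrder)
open import Data.List.Relation.Binary.Permutation.Propositional
  using (_↭_; ↭-sym; ↭-trans; ↭⇒↭ₛ)
open import Data.List.Relation.Binary.Permutation.Propositional.Properties as ↭
  using (↭-map-inv; ∈-resp-↭)
open import Data.List.Relation.Binary.Permutation.Setoid.Properties using (Unique-resp-↭)
open import Data.List.Relation.Binary.Pointwise as Pointwise
  using (Pointwise; []; _∷_; Pointwise-length; Pointwise-≡⇒≡; ≡⇒Pointwise-≡)
open import Data.List.Relation.Unary.All as All using ()
open import Data.List.Relation.Unary.All.Properties using (¬Any⇒All¬)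
open import Data.List.Relation.Unary.AllPairs using ([]; _∷_)
open import Data.List.Relation.Unary.Any using (here; there)
open import Data.List.Relation.Unary.Unique.Propositional using (Unique)
open import Data.List.Relation.Unary.Unique.Propositional.Properties as Unique
  using (++⁺; filter⁺; allFin⁺)
import Data.List.Relation.Unary.Sorted.TotalOrder.Properties as Sorted
import Data.List.Sort.InsertionSort.Base
import Data.List.Sort.InsertionSort.Properties
open import Data.Nat using (zero; suc; pred; _+_; _∸_; _<_; _≤_; z≤n; s≤s; _<ᵇ_; _≡ᵇ_)
import Data.Nat.Properties as ℕ
open import Data.Nat.Properties
  using ( <⇒≤; ≤-antisym; ≤-total; ≤-refl; <⇒≢; ≮⇒≥; m∸n≡0⇒m≤n; n∸n≡0; m<m+n
        ; +-cancelˡ-≡; suc-injective; _<?_)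
open import Data.Product as Product using (_,_; ∃; proj₁; proj₂; uncurry)
open import Data.Product.Relation.Binary.Lex.Strict using (×-isStrictTotalOrder)
open import Data.Product.Relation.Binary.Pointwise.NonDependent using (≡×≡⇒≡; ≡⇒≡×≡)
open import Data.Sum as Sum using (_⊎_; inj₁; inj₂)
open import Function using (id; _∘_; _∘₂_; case_of_)
open import Function.Bundles
  using (_⇔_; mk⇔; mk↔ₛ′; module Equivalence; module Inverse; module Injection)
open import Function.Properties.Equivalence using () renaming (sym to ⇔-sym)
open import Function.Properties.Inverse using (↔-sym; ↔⇒↣)
open import Level using (0ℓ)
open import Relation.Binary using (Rel; StrictTotalOrder)
open import Relation.Binary.Construct.Closure.ReflexiveTransitive using (Star; ε; _◅_)
open import Relation.Binary.Definitions using (Trichotomous; tri<; tri≈; tri>)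
open import Relation.Binary.PropositionalEquality
  using (refl; sym; trans; cong; cong₂; subst; subst₂; setoid; isEquivalence; module ≡-Reasoning)
import Relation.Binary.Properties.StrictTotalOrder
open import Relation.Binary.Structures using (IsStrictTotalOrder)
open import Relation.Binary.Structures.Biased using (isStrictTotalOrderᶜ)
open import Relation.Nullary using (¬_; yes; no)
open import Relation.Nullary.Decidable using (T?)

open Equivalence using (to; from)

-- Strict total orders given by Boolean tests

IsEqualityTest : {A : Set} → (A → A → Bool) → Set
IsEqualityTest eq = ∀ {x y} → T (eq x y) ⇔ x ≡ y

IsStrictTotalOrderᵇ : {A : Set} → (A → A → Bool) → Set
IsStrictTotalOrderᵇ lt = IsStrictTotalOrder _≡_ (T ∘₂ lt)

isStrictTotalOrder-⇔ : ∀ {A : Set} {_≈_ _<_ _<′_ : Rel A 0ℓ} →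
  (∀ {x y} → x ≈ y ⇔ x ≡ y) → (∀ {x y} → x < y ⇔ x <′ y) →
  IsStrictTotalOrder _≈_ _<_ → IsStrictTotalOrder _≡_ _<′_
isStrictTotalOrder-⇔ {_<_ = _<_} {_<′_} ≈⇔≡ <⇔<′ sto = isStrictTotalOrderᶜ record
  { isEquivalence = isEquivalence
  ; trans = λ x<y y<z → to <⇔<′ (<-trans (from <⇔<′ x<y) (from <⇔<′ y<z))
  ; compare = compare′
  }
  where
  open IsStrictTotalOrder sto using (compare) renaming (trans to <-trans)
  compare′ : Trichotomous _≡_ _<′_
  compare′ x y with compare x y
  ... | tri< a ¬b ¬c = tri< (to <⇔<′ a) (¬b ∘ from ≈⇔≡) (¬c ∘ from <⇔<′)
  ... | tri≈ ¬a b ¬c = tri≈ (¬a ∘ from <⇔<′) (to ≈⇔≡ b) (¬c ∘ from <⇔<′)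
  ... | tri> ¬a ¬b c = tri> (¬a ∘ from <⇔<′) (¬b ∘ from ≈⇔≡) (to <⇔<′ c)

≡ᵇ-isEqualityTest : IsEqualityTest _≡ᵇ_
≡ᵇ-isEqualityTest = mk⇔ (ℕ.≡ᵇ⇒≡ _ _) (ℕ.≡⇒≡ᵇ _ _)

<ᵇ-isStrictTotalOrder : IsStrictTotalOrderᵇ _<ᵇ_
<ᵇ-isStrictTotalOrder =
  isStrictTotalOrder-⇔ (mk⇔ id id) (mk⇔ ℕ.<⇒<ᵇ (ℕ.<ᵇ⇒< _ _)) ℕ.<-isStrictTotalOrder

module _ {A : Set} {eq : A → A → Bool} (eq-test : IsEqualityTest eq) where

  T-lexStep : ∀ (lt : A → A → Bool) x y b →
              T (lt x y ∨ (eq x y ∧ b)) ⇔ (T (lt x y) ⊎ (x ≡ y × T b))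
  T-lexStep lt x y b = mk⇔
    (Sum.map₂ (Product.map₁ (to eq-test) ∘ to T-∧) ∘ to T-∨)
    (from T-∨ ∘ Sum.map₂ (from T-∧ ∘ Product.map₁ (from eq-test)))

  lexEq-isEqualityTest : IsEqualityTest (lexEq eq)
  lexEq-isEqualityTest {[]}     {[]}     = mk⇔ (λ _ → refl) _
  lexEq-isEqualityTest {[]}     {_ ∷ _}  = mk⇔ (λ ()) (λ ())
  lexEq-isEqualityTest {_ ∷ _}  {[]}     = mk⇔ (λ ()) (λ ())
  lexEq-isEqualityTest {x ∷ xs} {y ∷ ys} = mk⇔
    (uncurry (cong₂ _∷_) ∘ Product.map (to eq-test) (to lexEq-isEqualityTest) ∘ to T-∧)
    (λ { refl → from T-∧ (from (eq-test {x}) refl , from (lexEq-isEqualityTest {xs}) refl) })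

  T-lexLt⇔Lex-< : ∀ {lt : A → A → Bool} xs ys →
                  T (lexLt lt eq xs ys) ⇔ Lex-< _≡_ (T ∘₂ lt) xs ys
  T-lexLt⇔Lex-< []       []       = mk⇔ (λ ()) (λ { (base ()) })
  T-lexLt⇔Lex-< []       (_ ∷ _)  = mk⇔ (λ _ → halt) _
  T-lexLt⇔Lex-< (_ ∷ _)  []       = mk⇔ (λ ()) (λ ())
  T-lexLt⇔Lex-< {lt} (x ∷ xs) (y ∷ ys) = mk⇔
    (Sum.[ this , uncurry (λ x≡y → next x≡y ∘ to (T-lexLt⇔Lex-< xs ys)) ]′
      ∘ to (T-lexStep lt x y _))
    (λ { (this x<y)   → from (T-lexStep lt x y _) (inj₁ x<y)
       ; (next x≡y r) → from (T-lexStep lt x y _) (inj₂ (x≡y , from (T-lexLt⇔Lex-< xs ys) r)) })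

  lexLt-isStrictTotalOrder : ∀ (lt : A → A → Bool) →
    IsStrictTotalOrderᵇ lt → IsStrictTotalOrderᵇ (lexLt lt eq)
  lexLt-isStrictTotalOrder lt sto = isStrictTotalOrder-⇔
    (mk⇔ Pointwise-≡⇒≡ ≡⇒Pointwise-≡) (⇔-sym (T-lexLt⇔Lex-< _ _)) (<-isStrictTotalOrder sto)

keyLt-isStrictTotalOrder : IsStrictTotalOrderᵇ keyLt
keyLt-isStrictTotalOrder = isStrictTotalOrder-⇔ (mk⇔ ≡×≡⇒≡ ≡⇒≡×≡)
  (λ {(c , a)} {(d , b)} → ⇔-sym (T-lexStep ≡ᵇ-isEqualityTest _<ᵇ_ c d (ltLL a b)))
  (×-isStrictTotalOrder <ᵇ-isStrictTotalOrder ltLL-isStrictTotalOrder)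
  where
  ltLL-isStrictTotalOrder : IsStrictTotalOrderᵇ ltLL
  ltLL-isStrictTotalOrder =
    lexLt-isStrictTotalOrder (lexEq-isEqualityTest ≡ᵇ-isEqualityTest) ltL
      (lexLt-isStrictTotalOrder ≡ᵇ-isEqualityTest _<ᵇ_ <ᵇ-isStrictTotalOrder)

-- Sorting keys

Key : Set
Key = ℕ × List (List ℕ)

keyStrictTotalOrder : StrictTotalOrder 0ℓ 0ℓ 0ℓ
keyStrictTotalOrder = record { isStrictTotalOrder = keyLt-isStrictTotalOrder }

open Relation.Binary.Properties.StrictTotalOrder keyStrictTotalOrder using (decTotalOrder; totalOrder)
module InsertionSort = Data.List.Sort.InsertionSort.Base decTotalOrder
open Data.List.Sort.InsertionSort.Properties decTotalOrder using (sort-↭; sort-↗)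

insert≡insertionSort-insert : ∀ x ys → insert x ys ≡ InsertionSort.insert x ys
insert≡insertionSort-insert x []       = refl
insert≡insertionSort-insert x (y ∷ ys)
  with IsStrictTotalOrder.compare keyLt-isStrictTotalOrder x y | keyLt y x in y<ᵇx
... | tri< _ _ y≮x | true  = ⊥-elim (y≮x (from T-≡ y<ᵇx))
... | tri< _ _ _   | false = refl
... | tri≈ _ _ y≮x | true  = ⊥-elim (y≮x (from T-≡ y<ᵇx))
... | tri≈ _ _ _   | false = refl
... | tri> _ _ _   | true  = cong (y ∷_) (insert≡insertionSort-insert x ys)
... | tri> _ _ y<x | false = ⊥-elim (subst T y<ᵇx y<x)

sortKeys≡insertionSort : ∀ xs → sortKeys xs ≡ InsertionSort.sort xs
sortKeys≡insertionSort []       = refl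
sortKeys≡insertionSort (x ∷ xs) =
  trans (cong (insert x) (sortKeys≡insertionSort xs))
        (insert≡insertionSort-insert x (InsertionSort.sort xs))

sortKeys-↭ : ∀ xs → sortKeys xs ↭ xs
sortKeys-↭ xs rewrite sortKeys≡insertionSort xs = sort-↭ xs

sortKeys-cong-↭ : ∀ {xs ys} → xs ↭ ys → sortKeys xs ≡ sortKeys ys
sortKeys-cong-↭ {xs} {ys} xs↭ys rewrite sortKeys≡insertionSort xs | sortKeys≡insertionSort ys =
  Pointwise-≡⇒≡ (Sorted.↗↭↗⇒≋ totalOrder (sort-↗ xs) (sort-↗ ys) (↭⇒↭ₛ
    (↭-trans (sort-↭ xs) (↭-trans xs↭ys (↭-sym (sort-↭ ys))))))

module _ {A : Set} where

  filterB≡filter : ∀ (p : A → Bool) xs → filterB p xs ≡ filter (T? ∘ p) xs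
  filterB≡filter p []       = refl
  filterB≡filter p (x ∷ xs) with p x
  ... | true  = cong (x ∷_) (filterB≡filter p xs)
  ... | false = filterB≡filter p xs

module _ {A B : Set} where

  ∈-zip⁻ˡ : ∀ {x : A} {y : B} xs ys → (x , y) ∈ zip xs ys → x ∈ xs
  ∈-zip⁻ˡ (_ ∷ _)  (_ ∷ _)  (here refl) = here refl
  ∈-zip⁻ˡ (_ ∷ xs) (_ ∷ ys) (there p)   = there (∈-zip⁻ˡ xs ys p)

  ∈-zip⁻ʳ : ∀ {x : A} {y : B} xs ys → (x , y) ∈ zip xs ys → y ∈ ys
  ∈-zip⁻ʳ (_ ∷ _)  (_ ∷ _)  (here refl) = here refl
  ∈-zip⁻ʳ (_ ∷ xs) (_ ∷ ys) (there p)   = there (∈-zip⁻ʳ xs ys p)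

  ∈-zip-swap : ∀ {x : A} {y : B} xs ys → (x , y) ∈ zip xs ys → (y , x) ∈ zip ys xs
  ∈-zip-swap (_ ∷ _)  (_ ∷ _)  (here refl) = here refl
  ∈-zip-swap (_ ∷ xs) (_ ∷ ys) (there p)   = there (∈-zip-swap xs ys p)

  ∈-zip-partner : ∀ {x : A} xs (ys : List B) → x ∈ xs → length xs ≡ length ys →
                  ∃ λ y → (x , y) ∈ zip xs ys
  ∈-zip-partner (_ ∷ _)  (y ∷ _)  (here refl) _   = y , here refl
  ∈-zip-partner (_ ∷ xs) (_ ∷ ys) (there x∈)  |≡|
    with y , p ← ∈-zip-partner xs ys x∈ (cong pred |≡|) = y , there p

  zip-functional : ∀ {x : A} {y y′ : B} {xs ys} → Unique xs →
                   (x , y) ∈ zip xs ys → (x , y′) ∈ zip xs ys → y ≡ y′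
  zip-functional {xs = _ ∷ _}  {_ ∷ _}  _        (here refl) (here refl) = refl
  zip-functional {xs = _ ∷ xs} {_ ∷ ys} (x≢ ∷ _) (here refl) (there p)   =
    ⊥-elim (All.lookup x≢ (∈-zip⁻ˡ xs ys p) refl)
  zip-functional {xs = _ ∷ xs} {_ ∷ ys} (x≢ ∷ _) (there p)   (here refl) =
    ⊥-elim (All.lookup x≢ (∈-zip⁻ˡ xs ys p) refl)
  zip-functional {xs = _ ∷ _}  {_ ∷ _}  (_ ∷ u)  (there p)   (there q)   = zip-functional u p q

  zip-++ : ∀ (xs : List A) (ys : List B) {xs′ ys′} → length xs ≡ length ys →
           zip (xs ++ xs′) (ys ++ ys′) ≡ zip xs ys ++ zip xs′ ys′
  zip-++ []       []       _   = refl
  zip-++ (x ∷ xs) (y ∷ ys) |≡| = cong ((x , y) ∷_) (zip-++ xs ys (cong pred |≡|))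

  Pointwise-∈-zip : ∀ {R : A → B → Set} {x y xs ys} →
                    Pointwise R xs ys → (x , y) ∈ zip xs ys → R x y
  Pointwise-∈-zip (r ∷ _)  (here refl) = r
  Pointwise-∈-zip (_ ∷ rs) (there p)   = Pointwise-∈-zip rs p

  concatMap-unique : ∀ {f : A → List B} {xs} →
    Unique xs → (∀ {x} → x ∈ xs → Unique (f x)) →
    (∀ {x y z} → x ∈ xs → y ∈ xs → z ∈ f x → z ∈ f y → x ≡ y) →
    Unique (concatMap f xs)
  concatMap-unique          []                 _        _          = []
  concatMap-unique {f = f} (x≢ ∷ xs-unique) f-unique same-image =
    ++⁺ (f-unique (here refl))
        (concatMap-unique xs-unique (f-unique ∘ there) (λ p q → same-image (there p) (there q)))
        (λ (z∈fx , z∈rest) → let y , y∈xs , z∈fy = find (∈-concatMap⁻ f z∈rest)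
                             in All.lookup x≢ y∈xs (same-image (here refl) (there y∈xs) z∈fx z∈fy))

module _ {A B C D : Set} where

  zip-concatMap : ∀ (f : A → List C) (g : B → List D) {xs ys} →
    Pointwise (λ x y → length (f x) ≡ length (g y)) xs ys →
    zip (concatMap f xs) (concatMap g ys) ≡ concatMap (uncurry λ x y → zip (f x) (g y)) (zip xs ys)
  zip-concatMap f g []                          = refl
  zip-concatMap f g {x ∷ _} {y ∷ _} (|≡| ∷ rs) =
    trans (zip-++ (f x) (g y) |≡|) (cong (zip (f x) (g y) ++_) (zip-concatMap f g rs))

-- Prefix codes

module _ {A : Set} where

  -- The shape of an LD array: a head h followed by length h sub-arrays.
  data Code : List (List A) → Set
  data Codes : ℕ → List (List A) → Set

  data Code where
    node : ∀ h {cs} → Codes (length h) cs → Code (h ∷ cs)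

  data Codes where
    []  : Codes 0 []
    _∷_ : ∀ {c cs m} → Code c → Codes m cs → Codes (suc m) (c ++ cs)

  code-split  : ∀ {a b r s} → Code a → Code b → a ++ r ≡ b ++ s → a ≡ b × r ≡ s
  codes-split : ∀ {m a b r s} → Codes m a → Codes m b → a ++ r ≡ b ++ s → a ≡ b × r ≡ s

  code-split (node h cs) (node _ cs′) eq
    with refl , eq′ ← ∷-injective eq
    with refl , r≡s ← codes-split cs cs′ eq′ = refl , r≡s

  codes-split []       []         eq = refl , eq
  codes-split {r = r} {s} (_∷_ {c} {cs} c₁ cs₁) (_∷_ {c′} {cs′} c₂ cs₂) eq
    with refl , eq′ ← code-split c₁ c₂
                        (trans (sym (++-assoc c cs r)) (trans eq (++-assoc c′ cs′ s)))
    with refl , r≡s ← codes-split cs₁ cs₂ eq′ = refl , r≡s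

module _ {A C : Set} {f : A → List (List C)} where

  codes-concatMap : (∀ x → Code (f x)) → ∀ xs → Codes (length xs) (concatMap f xs)
  codes-concatMap code-f []       = []
  codes-concatMap code-f (x ∷ xs) = code-f x ∷ codes-concatMap code-f xs

module _ {A B C : Set} {f : A → List (List C)} {g : B → List (List C)} where

  concatMap-codes-injective : (∀ x → Code (f x)) → (∀ y → Code (g y)) → ∀ {xs ys} →
    length xs ≡ length ys → concatMap f xs ≡ concatMap g ys → Pointwise (λ x y → f x ≡ g y) xs ys
  concatMap-codes-injective code-f code-g {[]}    {[]}    _   _  = []
  concatMap-codes-injective code-f code-g {x ∷ _} {y ∷ _} |≡| eq
    with fx≡gy , rest≡ ← code-split (code-f x) (code-g y) eq =
    fx≡gy ∷ concatMap-codes-injective code-f code-g (cong pred |≡|) rest≡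

-- Arborescences

module Arborescence (T : ColoredArborescence) where

  V : Set
  V = Fin (n T)

  infix 4 _⟶_
  _⟶_ : V → V → Set
  u ⟶ v = u ⟶[ E T ] v

  infixr 5 _∷_
  data Path : V → V → ℕ → Set where
    []  : ∀ {u} → Path u u 0
    _∷_ : ∀ {u v w L} → u ⟶ v → Path v w L → Path u w (suc L)

  infixr 5 _++ᵖ_
  _++ᵖ_ : ∀ {u v w i j} → Path u v i → Path v w j → Path u w (i + j)
  []      ++ᵖ q = q
  (e ∷ p) ++ᵖ q = e ∷ (p ++ᵖ q)

  Star⇒Path : ∀ {u v} → Star _⟶_ u v → ∃ (Path u v)
  Star⇒Path ε       = 0 , []
  Star⇒Path (e ◅ s) = let L , p = Star⇒Path s in suc L , e ∷ p

  unsnoc : ∀ {u w L} → Path u w (suc L) → ∃ λ v → Path u v L × v ⟶ w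
  unsnoc (e ∷ [])        = _ , [] , e
  unsnoc (e ∷ p@(_ ∷ _)) = let v , q , e′ = unsnoc p in v , e ∷ q , e′

  no-edge-to-root : ∀ {u} → ¬ (u ⟶ root T)
  no-edge-to-root {u} e = case trans (sym e) (root-no-parent T u) of λ ()

  parent-unique : ∀ {u u′ v} → u ⟶ v → u′ ⟶ v → u ≡ u′
  parent-unique {v = v} e e′ with v≢root ← (λ { refl → no-edge-to-root e })
    with p , _ , is-p ← unique-parent T v v≢root = trans (is-p _ e) (sym (is-p _ e′))

  -- Walk back from w one parent at a time; parents are unique.
  suffix-path : ∀ {u u′ w i j} → Path u w i → Path u′ w j → i ≤ j → Path u′ u (j ∸ i)
  suffix-path []        q         _         = q
  suffix-path p@(_ ∷ _) q@(_ ∷ _) (s≤s i≤j)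
    with v , p′ , v⟶w ← unsnoc p | v′ , q′ , v′⟶w ← unsnoc q
    with refl ← parent-unique v⟶w v′⟶w = suffix-path p′ q′ i≤j

  root-loop-length : ∀ {L} → Path (root T) (root T) L → L ≡ 0
  root-loop-length {zero}  _ = refl
  root-loop-length {suc L} p = ⊥-elim (no-edge-to-root (proj₂ (proj₂ (unsnoc p))))

  depth-unique : ∀ {w i j} → Path (root T) w i → Path (root T) w j → i ≡ j
  depth-unique {i = i} {j} p q with ≤-total i j
  ... | inj₁ i≤j = ≤-antisym i≤j (m∸n≡0⇒m≤n (root-loop-length (suffix-path p q i≤j)))
  ... | inj₂ j≤i = ≤-antisym (m∸n≡0⇒m≤n (root-loop-length (suffix-path q p j≤i))) j≤i

  vertexAt : ∀ {u v L} → Path u v L → Fin (suc L) → V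
  vertexAt {u} _       zero    = u
  vertexAt     (_ ∷ p) (suc i) = vertexAt p i

  prefix : ∀ {u v L} (p : Path u v L) (i : Fin (suc L)) → Path u (vertexAt p i) (toℕ i)
  prefix _       zero    = []
  prefix (e ∷ p) (suc i) = e ∷ prefix p i

  -- A path from the root of length ≥ n would visit some vertex twice, at two different depths.
  root-path-< : ∀ {v L} → Path (root T) v L → L < n T
  root-path-< {L = L} p with L <? n T
  ... | yes L<n = L<n
  ... | no  L≮n with i , j , i<j , same ← pigeonhole (s≤s (≮⇒≥ L≮n)) (vertexAt p) =
    ⊥-elim (<⇒≢ i<j (depth-unique (prefix p i)
                                  (subst (λ x → Path (root T) x (toℕ j)) (sym same) (prefix p j))))

  root-path : ∀ v → ∃ (Path (root T) v)
  root-path v = Star⇒Path (reachable T v)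

  no-cycle : ∀ {u v L} → u ⟶ v → ¬ Path v u L
  no-cycle e p with m , q ← root-path _ = <⇒≢ (m<m+n m (s≤s z≤n)) (depth-unique q (q ++ᵖ e ∷ p))

  common-descendant⇒same-child : ∀ {u v v′ w i j} →
    u ⟶ v → u ⟶ v′ → Path v w i → Path v′ w j → v ≡ v′
  common-descendant⇒same-child {i = i} e e′ p p′ with m , q ← root-path _
    with refl ← suc-injective (+-cancelˡ-≡ m _ _
                  (depth-unique (q ++ᵖ e ∷ p) (q ++ᵖ e′ ∷ p′)))
    = sym (path-length-0 (subst (Path _ _) (n∸n≡0 i) (suffix-path p p′ ≤-refl)))
    where
    path-length-0 : ∀ {x y} → Path x y 0 → x ≡ y
    path-length-0 [] = refl

  -- Fuel k suffices for LDfuel T k u to reach all of T[u].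
  Bounded : ℕ → V → Set
  Bounded k u = ∀ {w L} → Path u w L → L < k

  root-bounded : Bounded (n T) (root T)
  root-bounded = root-path-<

  child-bounded : ∀ {k u v} → Bounded (suc k) u → u ⟶ v → Bounded k v
  child-bounded bounded e p with s≤s L<k ← bounded (e ∷ p) = L<k

  ¬bounded-0 : ∀ {u} → ¬ Bounded 0 u
  ¬bounded-0 bounded = case bounded [] of λ ()

  ∈-children : ∀ {u v} → v ∈ children T u ⇔ u ⟶ v
  ∈-children {u} {v} rewrite filterB≡filter (E T u) (allFin (n T)) = mk⇔
    (to T-≡ ∘ proj₂ ∘ ∈-filter⁻ (T? ∘ E T u) {xs = allFin (n T)})
    (∈-filter⁺ (T? ∘ E T u) (∈-allFin v) ∘ from T-≡)

  children-unique : ∀ u → Unique (children T u)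
  children-unique u rewrite filterB≡filter (E T u) (allFin (n T)) =
    filter⁺ (T? ∘ E T u) (allFin⁺ (n T))

  key : ℕ → V → Key
  key k v = colour T v , LDfuel T k v

  private
    sorting : ∀ k u → ∃ λ vs →
      sortKeys (map (key k) (children T u)) ≡ map (key k) vs × children T u ↭ vs
    sorting k u = ↭-map-inv (key k) (↭-sym (sortKeys-↭ _))

  -- The children in the order in which LDfuel T (suc k) u lists them; children with
  -- equal keys come in an unspecified order.
  sortedChildren : ℕ → V → List V
  sortedChildren k u = proj₁ (sorting k u)

  LDfuel-suc : ∀ k u → LDfuel T (suc k) u ≡
    map (colour T) (sortedChildren k u) ∷ concatMap (LDfuel T k) (sortedChildren k u)
  LDfuel-suc k u = begin
    map proj₁ sorted ∷ concat (map proj₂ sorted)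
      ≡⟨ cong (λ ks → map proj₁ ks ∷ concat (map proj₂ ks)) (proj₁ (proj₂ (sorting k u))) ⟩
    map proj₁ (map (key k) vs) ∷ concat (map proj₂ (map (key k) vs))
      ≡⟨ cong₂ (λ cs ds → cs ∷ concat ds) (sym (map-∘ vs)) (sym (map-∘ vs)) ⟩
    map (colour T) vs ∷ concatMap (LDfuel T k) vs ∎
    where
    open ≡-Reasoning
    sorted : List Key
    sorted = sortKeys (map (key k) (children T u))
    vs : List V
    vs = sortedChildren k u

  ∈-sortedChildren : ∀ {k u v} → v ∈ sortedChildren k u ⇔ u ⟶ v
  ∈-sortedChildren {k} {u} = mk⇔
    (to ∈-children ∘ ∈-resp-↭ (↭-sym (proj₂ (proj₂ (sorting k u)))))
    (∈-resp-↭ (proj₂ (proj₂ (sorting k u))) ∘ from ∈-children)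

  sortedChildren-unique : ∀ k u → Unique (sortedChildren k u)
  sortedChildren-unique k u =
    Unique-resp-↭ (setoid V) (↭⇒↭ₛ (proj₂ (proj₂ (sorting k u)))) (children-unique u)

  -- The vertices of T[u] in the order in which LDfuel T k u describes them, one entry each.
  preorder    : ℕ → V → List V
  descendants : ℕ → V → List V

  preorder k u = u ∷ descendants k u

  descendants zero    u = []
  descendants (suc k) u = concatMap (preorder k) (sortedChildren k u)

  length-preorder : ∀ k u → length (preorder k u) ≡ length (LDfuel T k u)
  length-preorder zero    u = refl
  length-preorder (suc k) u = begin
    suc (length (concatMap (preorder k) vs))  ≡⟨ cong suc (length-concatMap vs) ⟩
    suc (length (concatMap (LDfuel T k) vs))  ≡⟨ cong length (LDfuel-suc k u) ⟨
    length (LDfuel T (suc k) u)               ∎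
    where
    open ≡-Reasoning
    vs : List V
    vs = sortedChildren k u
    length-concatMap : ∀ ws → length (concatMap (preorder k) ws) ≡ length (concatMap (LDfuel T k) ws)
    length-concatMap []       = refl
    length-concatMap (w ∷ ws) = begin
      length (preorder k w ++ concatMap (preorder k) ws)
        ≡⟨ length-++ (preorder k w) ⟩
      length (preorder k w) + length (concatMap (preorder k) ws)
        ≡⟨ cong₂ _+_ (length-preorder k w) (length-concatMap ws) ⟩
      length (LDfuel T k w) + length (concatMap (LDfuel T k) ws)
        ≡⟨ length-++ (LDfuel T k w) ⟨
      length (LDfuel T k w ++ concatMap (LDfuel T k) ws)
        ∎

  ∈-descendants⁻ : ∀ k u {w} → w ∈ descendants (suc k) u → ∃ λ v → u ⟶ v × w ∈ preorder k v
  ∈-descendants⁻ k u w∈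
    with v , v∈ , w∈′ ← find (∈-concatMap⁻ (preorder k) {xs = sortedChildren k u} w∈) =
    v , to ∈-sortedChildren v∈ , w∈′

  preorder-sound : ∀ k u {w} → w ∈ preorder k u → ∃ (Path u w)
  preorder-sound k       u (here refl) = 0 , []
  preorder-sound (suc k) u (there w∈)
    with v , u⟶v , w∈′ ← ∈-descendants⁻ k u w∈
    with L , p ← preorder-sound k v w∈′ = suc L , u⟶v ∷ p

  preorder-complete : ∀ k {u w L} → Path u w L → L ≤ k → w ∈ preorder k u
  preorder-complete k       []      _         = here refl
  preorder-complete (suc k) (e ∷ p) (s≤s L≤k) =
    there (∈-concatMap⁺ (preorder k) (lose (from ∈-sortedChildren e) (preorder-complete k p L≤k)))

  ∉-descendants : ∀ k u → u ∉ descendants k u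
  ∉-descendants (suc k) u u∈ with v , u⟶v , u∈′ ← ∈-descendants⁻ k u u∈ =
    no-cycle u⟶v (proj₂ (preorder-sound k v u∈′))

  preorder-unique    : ∀ k u → Unique (preorder k u)
  descendants-unique : ∀ k u → Unique (descendants k u)

  preorder-unique k u = ¬Any⇒All¬ (descendants k u) (∉-descendants k u) ∷ descendants-unique k u

  descendants-unique zero    u = []
  descendants-unique (suc k) u =
    concatMap-unique (sortedChildren-unique k u) (λ {v} _ → preorder-unique k v)
      (λ v∈ v′∈ w∈ w∈′ → common-descendant⇒same-child
        (to ∈-sortedChildren v∈) (to ∈-sortedChildren v′∈)
        (proj₂ (preorder-sound k _ w∈)) (proj₂ (preorder-sound k _ w∈′)))

  LDfuel-code : ∀ k u → Code (LDfuel T k u)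
  LDfuel-code zero    u = node [] []
  LDfuel-code (suc k) u = subst Code (sym (LDfuel-suc k u)) (node (map (colour T) vs) children-codes)
    where
    vs : List V
    vs = sortedChildren k u
    children-codes : Codes (length (map (colour T) vs)) (concatMap (LDfuel T k) vs)
    children-codes = subst (λ m → Codes m (concatMap (LDfuel T k) vs)) (sym (length-map (colour T) vs))
                           (codes-concatMap (LDfuel-code k) vs)

  ∈-preorder-root : ∀ v → v ∈ preorder (n T) (root T)
  ∈-preorder-root v = let _ , p = root-path v in preorder-complete (n T) p (<⇒≤ (root-path-< p))

-- Equal arrays give an isomorphism

module Matching (T T′ : ColoredArborescence) where
  private
    module A = Arborescence T
    module B = Arborescence T′

  Forth : (Z W : List (A.V × B.V)) → Set
  Forth Z W = ∀ {a a′ b} → (a , a′) ∈ Z → a A.⟶ b →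
              ∃ λ b′ → a′ B.⟶ b′ × colour T b ≡ colour T′ b′ × (b , b′) ∈ W

  pairing : ℕ → ℕ → A.V → B.V → List (A.V × B.V)
  pairing k k′ u u′ = zip (A.preorder k u) (B.preorder k′ u′)

  -- Equal arrays split into equal colour lists and, being prefix codes, equal arrays of
  -- corresponding children; so the two listings split into aligned blocks, one for each
  -- pair of corresponding children.
  pairing-forth : ∀ k k′ {u u′} → A.Bounded k u → B.Bounded k′ u′ →
                  LDfuel T k u ≡ LDfuel T′ k′ u′ → Forth (pairing k k′ u u′) (pairing k k′ u u′)
  pairing-forth zero    _        bounded _        _  = ⊥-elim (A.¬bounded-0 bounded)
  pairing-forth (suc k) zero     _       bounded′ _  = ⊥-elim (B.¬bounded-0 bounded′)
  pairing-forth (suc k) (suc k′) {u} {u′} bounded bounded′ same = forth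
    where
    vs : List A.V
    vs = A.sortedChildren k u
    vs′ : List B.V
    vs′ = B.sortedChildren k′ u′

    same′ : map (colour T) vs ∷ concatMap (LDfuel T k) vs ≡
            map (colour T′) vs′ ∷ concatMap (LDfuel T′ k′) vs′
    same′ = trans (sym (A.LDfuel-suc k u)) (trans same (B.LDfuel-suc k′ u′))

    same-colours : Pointwise (λ v v′ → colour T v ≡ colour T′ v′) vs vs′
    same-colours = Pointwise.map⁻ (colour T) (colour T′) (≡⇒Pointwise-≡ (proj₁ (∷-injective same′)))

    same-arrays : Pointwise (λ v v′ → LDfuel T k v ≡ LDfuel T′ k′ v′) vs vs′
    same-arrays = concatMap-codes-injective (A.LDfuel-code k) (B.LDfuel-code k′)
      (Pointwise-length same-colours) (proj₂ (∷-injective same′))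

    descendants-pairing : zip (A.descendants (suc k) u) (B.descendants (suc k′) u′) ≡
                          concatMap (uncurry (pairing k k′)) (zip vs vs′)
    descendants-pairing =
      zip-concatMap (A.preorder k) (B.preorder k′) (Pointwise.map same-length same-arrays)
      where
      same-length : ∀ {v v′} → LDfuel T k v ≡ LDfuel T′ k′ v′ →
                    length (A.preorder k v) ≡ length (B.preorder k′ v′)
      same-length {v} {v′} eq =
        trans (A.length-preorder k v) (trans (cong length eq) (sym (B.length-preorder k′ v′)))

    ∈-child-pairing : ∀ {v v′ b b′} → (v , v′) ∈ zip vs vs′ → (b , b′) ∈ pairing k k′ v v′ →
                      (b , b′) ∈ pairing (suc k) (suc k′) u u′
    ∈-child-pairing vv′∈ bb′∈ =
      there (subst (_ ∈_) (sym descendants-pairing)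
                   (∈-concatMap⁺ (uncurry (pairing k k′)) (lose vv′∈ bb′∈)))

    forth : Forth (pairing (suc k) (suc k′) u u′) (pairing (suc k) (suc k′) u u′)
    forth (here refl) u⟶b
      with b′ , bb′∈ ← ∈-zip-partner vs vs′ (from A.∈-sortedChildren u⟶b) (Pointwise-length same-colours) =
      b′ , to B.∈-sortedChildren (∈-zip⁻ʳ vs vs′ bb′∈) , Pointwise-∈-zip same-colours bb′∈ ,
      ∈-child-pairing bb′∈ (here refl)
    forth (there aa′∈) a⟶b
      with (v , v′) , vv′∈ , aa′∈′ ←
             find (∈-concatMap⁻ (uncurry (pairing k k′)) (subst (_ ∈_) descendants-pairing aa′∈))
      with b′ , a′⟶b′ , same-colour , bb′∈ ← pairing-forth k k′
             (A.child-bounded bounded (to A.∈-sortedChildren (∈-zip⁻ˡ vs vs′ vv′∈)))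
             (B.child-bounded bounded′ (to B.∈-sortedChildren (∈-zip⁻ʳ vs vs′ vv′∈)))
             (Pointwise-∈-zip same-arrays vv′∈) aa′∈′ a⟶b =
      b′ , a′⟶b′ , same-colour , ∈-child-pairing vv′∈ bb′∈

module Pairing (T T′ : ColoredArborescence) (same : LD T ≡ LD T′) where
  private
    module A = Arborescence T
    module B = Arborescence T′
    open Matching T T′

    P : List A.V
    P = A.preorder (n T) (root T)
    P′ : List B.V
    P′ = B.preorder (n T′) (root T′)

    |P|≡|P′| : length P ≡ length P′
    |P|≡|P′| = trans (A.length-preorder (n T) (root T))
                     (trans (cong length same) (sym (B.length-preorder (n T′) (root T′))))

  f : A.V → B.V
  f a = proj₁ (∈-zip-partner P P′ (A.∈-preorder-root a) |P|≡|P′|)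

  ∈-pairing : ∀ a → (a , f a) ∈ zip P P′
  ∈-pairing a = proj₂ (∈-zip-partner P P′ (A.∈-preorder-root a) |P|≡|P′|)

  ∈-pairing⇒≡f : ∀ {a b} → (a , b) ∈ zip P P′ → f a ≡ b
  ∈-pairing⇒≡f {a} ab∈ = zip-functional (A.preorder-unique (n T) (root T)) (∈-pairing a) ab∈

  f-root : f (root T) ≡ root T′
  f-root = ∈-pairing⇒≡f (here refl)

  f-forth : ∀ {u v} → u A.⟶ v → f u B.⟶ f v × colour T v ≡ colour T′ (f v)
  f-forth {u} u⟶v
    with b′ , fu⟶b′ , same-colour , vb′∈ ←
           pairing-forth (n T) (n T′) A.root-bounded B.root-bounded same (∈-pairing u) u⟶v
    with refl ← ∈-pairing⇒≡f vb′∈ = fu⟶b′ , same-colour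

module _ {T T′ : ColoredArborescence} (same : LDbar T ≡ LDbar T′) where
  private
    module A = Arborescence T
    module F = Pairing T T′ (proj₂ (∷-injective same))
    module G = Pairing T′ T (sym (proj₂ (∷-injective same)))

    f∘g : ∀ y → F.f (G.f y) ≡ y
    f∘g y = F.∈-pairing⇒≡f (∈-zip-swap _ _ (G.∈-pairing y))

    g∘f : ∀ x → G.f (F.f x) ≡ x
    g∘f x = G.∈-pairing⇒≡f (∈-zip-swap _ _ (F.∈-pairing x))

    edges : ∀ u v → E T′ (F.f u) (F.f v) ≡ E T u v
    edges u v = ⇔→≡ (mk⇔ (subst₂ A._⟶_ (g∘f u) (g∘f v) ∘ proj₁ ∘ G.f-forth) (proj₁ ∘ F.f-forth))

    colours : ∀ u → colour T′ (F.f u) ≡ colour T u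
    colours u with u Fin.≟ root T
    ... | yes refl = trans (cong (colour T′) F.f-root) (sym root-colour)
      where
      root-colour : colour T (root T) ≡ colour T′ (root T′)
      root-colour = proj₁ (∷-injective (proj₁ (∷-injective same)))
    ... | no u≢root with _ , p⟶u , _ ← unique-parent T u u≢root = sym (proj₂ (F.f-forth p⟶u))

  same-LDbar⇒isomorphic : Isomorphic T T′
  same-LDbar⇒isomorphic = record { bij = mk↔ₛ′ F.f G.f f∘g g∘f ; edges = edges ; colours = colours }

-- Isomorphisms preserve the array

module _ {T T′ : ColoredArborescence} (iso : Isomorphic T T′) where
  private
    module A = Arborescence T
    module B = Arborescence T′
    open ColIso iso

    g : B.V → A.V
    g = Inverse.from bij

    f∘g : ∀ y → f (g y) ≡ y
    f∘g = Inverse.strictlyInverseˡ bij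

    f-injective : ∀ {x y} → f x ≡ f y → x ≡ y
    f-injective = Injection.injective (↔⇒↣ bij)

    reflect : ∀ {u v} → f u B.⟶ f v → u A.⟶ v
    reflect {u} {v} = trans (sym (edges u v))

    preserve : ∀ {u v} → u A.⟶ v → f u B.⟶ f v
    preserve {u} {v} = trans (edges u v)

    f-root : f (root T) ≡ root T′
    f-root with f (root T) Fin.≟ root T′
    ... | yes f-root≡root = f-root≡root
    ... | no  f-root≢root with p , p⟶ , _ ← unique-parent T′ _ f-root≢root =
      ⊥-elim (A.no-edge-to-root (reflect (subst (B._⟶ f (root T)) (sym (f∘g p)) p⟶)))

    children-↭ : ∀ u → map f (children T u) ↭ children T′ (f u)
    children-↭ u = ∼bag⇒↭ (unique∧set⇒bag
      (Unique.map⁺ f-injective (A.children-unique u)) (B.children-unique (f u)) same-members)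
      where
      same-members : map f (children T u) ∼[ set ] children T′ (f u)
      same-members {z} = mk⇔
        (λ z∈ → let v , v∈ , z≡fv = ∈-map⁻ f z∈ in
          subst (_∈ children T′ (f u)) (sym z≡fv) (from B.∈-children (preserve (to A.∈-children v∈))))
        (λ z∈ → subst (_∈ map f (children T u)) (f∘g z)
          (∈-map⁺ f (from A.∈-children (reflect (subst (f u B.⟶_) (sym (f∘g z)) (to B.∈-children z∈))))))

    LDfuel-preserved : ∀ k u → LDfuel T k u ≡ LDfuel T′ k (f u)
    LDfuel-preserved zero    u = refl
    LDfuel-preserved (suc k) u = cong (λ ks → map proj₁ ks ∷ concat (map proj₂ ks)) (begin
      sortKeys (map (A.key k) (children T u))
        ≡⟨ cong sortKeys (map-cong key-preserved (children T u)) ⟩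
      sortKeys (map (B.key k ∘ f) (children T u))
        ≡⟨ cong sortKeys (map-∘ (children T u)) ⟩
      sortKeys (map (B.key k) (map f (children T u)))
        ≡⟨ sortKeys-cong-↭ (↭.map⁺ (B.key k) (children-↭ u)) ⟩
      sortKeys (map (B.key k) (children T′ (f u)))
        ∎)
      where
      open ≡-Reasoning
      key-preserved : ∀ v → A.key k v ≡ B.key k (f v)
      key-preserved v = cong₂ _,_ (sym (colours v)) (LDfuel-preserved k v)

  isomorphic⇒same-LDbar : LDbar T ≡ LDbar T′
  isomorphic⇒same-LDbar = cong₂ (λ c ld → (c ∷ []) ∷ ld)
    (trans (sym (colours (root T))) (cong (colour T′) f-root))
    (trans (LDfuel-preserved (n T) (root T)) (cong₂ (LDfuel T′) same-size f-root))
    where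
    same-size : n T ≡ n T′
    same-size = cantor-schröder-bernstein f-injective (Injection.injective (↔⇒↣ (↔-sym bij)))

proposition3p2 : (T T' : ColoredArborescence) →
    (Isomorphic T T' → LDbar T ≡ LDbar T') × (LDbar T ≡ LDbar T' → Isomorphic T T')
proposition3p2 T T' = isomorphic⇒same-LDbar , same-LDbar⇒isomorphic
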